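{- Let $G$ be a graph without isolated vertices with $mw(G) \geq t$, where $t>0$ is an integer, and let $Z$ be a uniform NROBP computing $\phi(G)$. Then every root-leaf path of $Z$ passes through a $t$-node of $Z$.
   Context: $\phi(G)$ is the monotone 2-CNF with variables $V(G)$ and clauses $(u\vee v)$ for $\{u,v\}\in E(G)$. Matching width: for a permutation $SV$ of $V(G)$ and a prefix $S_1$ of $SV$, the matching width of $S_1$ is the size of a largest matching of edges between $S_1$ and $V(G)\setminus S_1$; the matching width of $SV$ is the maximum over its prefixes; $mw(G)$ is the minimum over all permutations. An NROBP computing $F$ is a finite DAG (multiple edges allowed) with one root and one leaf, some edges labelled by literals of variables of $F$, with no directed path containing two edges labelled by literals of the same variable; for a path $P$, $A(P)$ is its set of edge labels; it computes $F$ if every total assignment containing $A(P)$ for a root-leaf path $P$ satisfies $F$, and every satisfying assignment of $F$ contains $A(P)$ for some root-leaf path $P$. It is uniform if any two root-to-$a$ paths (for every node $a$) use literals of the same variable set and every root-leaf path uses literals of all variables. For a root-leaf path $P$ of $Z$, $VC(P)$ is the set of vertices $v$ of $G$ such that the positive literal $v$ labels an edge of $P$. A node $a$ of $Z$ is a $t$-node if there is a set $S(a) \subseteq V(G)$ with $|S(a)| \geq t$ such that $S(a) \subseteq VC(P)$ for every root-leaf path $P$ of $Z$ passing through $a$. -}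

module Defs where

open import Data.Nat using (ℕ; _≤_; _<_)
open import Data.Fin using (Fin; toℕ)
open import Data.Fin.Permutation using (Permutation′; _⟨$⟩ʳ_)
open import Data.Fin.Subset using (Subset; _∈_; ∣_∣)
open import Data.Bool using (Bool; true; false)
open import Data.Maybe using (Maybe)
open import Data.List using (List; []; _∷_; length; concatMap; mapMaybe; map)
open import Data.List.Relation.Unary.All using (All)
open import Data.List.Relation.Unary.AllPairs using (AllPairs)
open import Data.List.Relation.Unary.Unique.Propositional using (Unique)
import Data.List.Membership.Propositional as LM
open import Data.Product using (Σ; ∃; ∃-syntax; _×_; _,_; proj₁; proj₂)
open import Data.Sum using (_⊎_)
open import Data.Empty using (⊥)
open import Data.Unit using (⊤)
open import Relation.Nullary using (¬_)
open import Relation.Binary.PropositionalEquality using (_≡_; _≢_)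
open import Function.Bundles using (_⇔_)

record Graph (n : ℕ) : Set₁ where
  field
    Adj    : Fin n → Fin n → Set
    sym    : ∀ {u v} → Adj u v → Adj v u
    irrefl : ∀ {u} → ¬ Adj u u
open Graph public

NoIsolated : ∀ {n} → Graph n → Set
NoIsolated {n} G = ∀ (v : Fin n) → ∃[ u ] Adj G v u

InPrefix : ∀ {n} → Permutation′ n → ℕ → Fin n → Set
InPrefix π i v = ∃[ j ] (toℕ j < i × π ⟨$⟩ʳ j ≡ v)

endpoints : ∀ {n} → List (Fin n × Fin n) → List (Fin n)
endpoints = concatMap (λ p → proj₁ p ∷ proj₂ p ∷ [])

IsCrossMatching : ∀ {n} → Graph n → (Fin n → Set) → List (Fin n × Fin n) → Set
IsCrossMatching G S M =
  All (λ p → S (proj₁ p) × ¬ S (proj₂ p) × Adj G (proj₁ p) (proj₂ p)) M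
  × Unique (endpoints M)

-- mw(G) ≥ t, unfolding mw(G) = min_π max_{prefix} (max cross matching size)
MwAtLeast : ∀ {n} → Graph n → ℕ → Set
MwAtLeast {n} G t =
  ∀ (π : Permutation′ n) →
    ∃[ i ] (i ≤ n × ∃[ M ] (IsCrossMatching G (InPrefix π i) M × t ≤ length M))

Lit : ℕ → Set
Lit n = Fin n × Bool      -- (v , true) = positive literal v, (v , false) = ¬v

var : ∀ {n} → Lit n → Fin n
var = proj₁

Assignment : ℕ → Set
Assignment n = Fin n → Bool

Holds : ∀ {n} → Assignment n → Lit n → Set
Holds σ l = σ (proj₁ l) ≡ proj₂ l

SatPhi : ∀ {n} → Graph n → Assignment n → Set
SatPhi G σ = ∀ u v → Adj G u v → σ u ≡ true ⊎ σ v ≡ true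

-- Branching programs: DAGs with multiple edges, edges Fin k, nodes Fin m

record BP (n : ℕ) : Set where
  field
    m k  : ℕ
    src  : Fin k → Fin m
    tgt  : Fin k → Fin m
    lab  : Fin k → Maybe (Lit n)
    root : Fin m
    leaf : Fin m

module _ {n : ℕ} (Z : BP n) where
  open BP Z

  data Path : Fin m → Fin m → Set where
    []   : ∀ {a} → Path a a
    step : ∀ {a b} (e : Fin k) → src e ≡ a → Path (tgt e) b → Path a b

  pathEdges : ∀ {a b} → Path a b → List (Fin k)
  pathEdges []           = []
  pathEdges (step e _ P) = e ∷ pathEdges P

  pathNodes : ∀ {a b} → Path a b → List (Fin m)
  pathNodes {b = b} []   = b ∷ []
  pathNodes {a = a} (step e _ P) = a ∷ pathNodes P

  -- A(P), as a list (with multiplicity) of edge labels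
  A : ∀ {a b} → Path a b → List (Lit n)
  A P = mapMaybe lab (pathEdges P)

  vars : ∀ {a b} → Path a b → List (Fin n)
  vars P = map var (A P)

  NonEmpty : ∀ {a b} → Path a b → Set
  NonEmpty []           = ⊥
  NonEmpty (step _ _ _) = ⊤

  Acyclic : Set
  Acyclic = ∀ {a} (P : Path a a) → ¬ NonEmpty P

  OneRootOneLeaf : Set
  OneRootOneLeaf =
    (∀ a → (∀ e → tgt e ≢ a) ⇔ (a ≡ root)) ×
    (∀ a → (∀ e → src e ≢ a) ⇔ (a ≡ leaf))

  ReadOnce : Set
  ReadOnce = ∀ {a b} (P : Path a b) → AllPairs (λ x y → var x ≢ var y) (A P)

  IsNROBP : Set
  IsNROBP = Acyclic × OneRootOneLeaf × ReadOnce

  Uniform : Set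
  Uniform =
    (∀ {a} (P Q : Path root a) → ∀ v → (v LM.∈ vars P) ⇔ (v LM.∈ vars Q)) ×
    (∀ (P : Path root leaf) → ∀ v → v LM.∈ vars P)

  Computes : (Assignment n → Set) → Set
  Computes F =
    (∀ (P : Path root leaf) (σ : Assignment n) → All (Holds σ) (A P) → F σ) ×
    (∀ (σ : Assignment n) → F σ → Σ (Path root leaf) (λ P → All (Holds σ) (A P)))

  InVC : Path root leaf → Fin n → Set
  InVC P v = (v , true) LM.∈ A P

  IsTNode : ℕ → Fin m → Set
  IsTNode t a =
    ∃[ S ] (t ≤ ∣ S ∣ ×
      (∀ (P : Path root leaf) → a LM.∈ pathNodes P → ∀ v → v ∈ S → InVC P v))

-- The order in which P reads the variables is a permutation of V(G), so mw(G) ≥ t gives a prefix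
-- S₁ of it and a matching of t edges between S₁ and the rest. Let a be the node of P at which S₁
-- has been read; by uniformity every path from the root to a reads exactly S₁. For a matching
-- edge uw with u ∈ S₁, either some path into a sets u false, and then every path through a must
-- set w true (else gluing would falsify the clause u ∨ w), or every path into a sets u true.
-- Either way one endpoint of each matching edge is forced true through a, giving t vertices.
module Submission where

open import Defs
open import Data.Nat using (ℕ; zero; suc; _<_; _≤_; z≤n; s≤s)
open import Data.Nat.Properties using (≤-trans; <⇒≤; _≤?_; ≰⇒>)
open import Data.Fin using (Fin; zero; suc; toℕ; cast; _≟_)
import Data.Fin as Fin
open import Data.Fin.Properties using (toℕ-cast; cast-involutive; pigeonhole; any?)
open import Data.Fin.Permutation using (Permutation; Permutation′; permutation; _∘ₚ_; cast-id; ↔⇒≡)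
open import Data.Fin.Subset using (Subset; ∣_∣; ⁅_⁆; _∪_)
import Data.Fin.Subset as Subset
open import Data.Fin.Subset.Properties using (∉⊥; x∈⁅y⁆⇒x≡y; x∈p∪q⁻; x∈p∪q⁺; x∈⁅x⁆; p⊂q⇒∣p∣<∣q∣; q⊆p∪q)
open import Data.Bool using (true; false; if_then_else_)
open import Data.Maybe using (Maybe; just; nothing)
import Data.Maybe.Properties as Maybe
import Data.Product.Properties as Product
import Data.Bool as Bool
open import Data.List using (List; []; _∷_; length; take; map; lookup; _++_; mapMaybe)
open import Data.List.Properties using (take-map; mapMaybe-++)
open import Data.List.Relation.Unary.All as All using (All; []; _∷_)
open import Data.List.Relation.Unary.All.Properties using (All¬⇒¬Any)
open import Data.List.Relation.Unary.Any using (here; there; index)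
open import Data.List.Relation.Unary.Any.Properties using (lookup-index)
open import Data.List.Relation.Unary.AllPairs using (AllPairs; []; _∷_)
import Data.List.Relation.Unary.AllPairs.Properties as AllPairs
open import Data.List.Relation.Unary.Unique.Propositional using (Unique)
open import Data.List.Relation.Binary.Pointwise using (Pointwise; []; _∷_; Pointwise-length)
open import Data.List.Membership.Propositional using (_∈_)
open import Data.List.Membership.Propositional.Properties using (∈-lookup; ∈-map⁺; ∈-map⁻; ∈-++⁺ˡ; ∈-++⁺ʳ; ∈-++⁻)
open import Data.List.Membership.Propositional.Properties.WithK using (unique⇒irrelevant)
open import Data.Product using (Σ; ∃-syntax; _×_; _,_; proj₁)
open import Data.Sum using (_⊎_; inj₁; inj₂; [_,_]′)
open import Data.Empty using (⊥-elim)
open import Data.Unit using (tt)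
open import Function using (_∘_)
open import Function.Bundles using (_⇔_; mk⇔; Equivalence)
open import Function.Construct.Symmetry using (⇔-sym)
open import Function.Construct.Composition using (_⇔-∘_)
open import Relation.Nullary using (¬_; Dec; yes; no; does)
open import Relation.Nullary.Decidable using (dec-true; dec-false; map′; _×-dec_; _⊎-dec_)
open import Relation.Binary.PropositionalEquality using (_≡_; _≢_; refl; trans; cong; subst)
import Relation.Binary.PropositionalEquality as ≡

∈-take⇔lookup : ∀ {A : Set} (i : ℕ) (xs : List A) {v} →
  v ∈ take i xs ⇔ (∃[ j ] (toℕ j < i × lookup xs j ≡ v))
∈-take⇔lookup i xs = mk⇔ (to i xs) (λ (j , j<i , eq) → from i xs j j<i eq)
  where
  to : ∀ {A : Set} i (xs : List A) {v} → v ∈ take i xs → ∃[ j ] (toℕ j < i × lookup xs j ≡ v)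
  to (suc i) (x ∷ xs) (here refl) = zero , s≤s z≤n , refl
  to (suc i) (x ∷ xs) (there v∈) with to i xs v∈
  ... | j , j<i , eq = suc j , s≤s j<i , eq
  from : ∀ {A : Set} i (xs : List A) {v} j → toℕ j < i → lookup xs j ≡ v → v ∈ take i xs
  from (suc i) (x ∷ xs) zero    _         refl = here refl
  from (suc i) (x ∷ xs) (suc j) (s≤s j<i) eq   = there (from i xs j j<i eq)

index-∈-lookup : ∀ {A : Set} (xs : List A) (j : Fin (length xs)) → index (∈-lookup {xs = xs} j) ≡ j
index-∈-lookup (x ∷ xs) zero    = refl
index-∈-lookup (x ∷ xs) (suc j) = cong suc (index-∈-lookup xs j)

enumeration⇒permutation : ∀ {n} (vs : List (Fin n)) → Unique vs → (∀ v → v ∈ vs) →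
  Σ (Permutation′ n) λ π → ∀ i v → InPrefix π i v ⇔ v ∈ take i vs
enumeration⇒permutation {n} vs unique enum = π , λ i v → prefix i v
  where
  position : Fin n → Fin (length vs)
  position v = index (enum v)

  lookup-position : ∀ v → lookup vs (position v) ≡ v
  lookup-position v = ≡.sym (lookup-index (enum v))

  position-lookup : ∀ j → position (lookup vs j) ≡ j
  position-lookup j = trans (cong index (unique⇒irrelevant unique (enum (lookup vs j)) (∈-lookup j)))
                            (index-∈-lookup vs j)

  enumerate : Permutation (length vs) n
  enumerate = permutation (lookup vs) position lookup-position position-lookup

  π : Permutation′ n
  π = cast-id (≡.sym (↔⇒≡ enumerate)) ∘ₚ enumerate

  prefix : ∀ i v → InPrefix π i v ⇔ v ∈ take i vs
  prefix i v = ⇔-sym (∈-take⇔lookup i vs) ⇔-∘ mk⇔ to from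
    where
    to : InPrefix π i v → ∃[ j ] (toℕ j < i × lookup vs j ≡ v)
    to (j , j<i , eq) = cast _ j , subst (_< i) (≡.sym (toℕ-cast _ j)) j<i , eq
    from : ∃[ j ] (toℕ j < i × lookup vs j ≡ v) → InPrefix π i v
    from (j , j<i , eq) = cast (↔⇒≡ enumerate) j , subst (_< i) (≡.sym (toℕ-cast _ j)) j<i ,
                          trans (cong (lookup vs) (cast-involutive _ (↔⇒≡ enumerate) j)) eq

fromList : ∀ {n} → List (Fin n) → Subset n
fromList []       = Subset.⊥
fromList (c ∷ cs) = ⁅ c ⁆ ∪ fromList cs

∈-fromList⁻ : ∀ {n} (cs : List (Fin n)) {x} → x Subset.∈ fromList cs → x ∈ cs
∈-fromList⁻ []       x∈ = ⊥-elim (∉⊥ x∈)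
∈-fromList⁻ (c ∷ cs) x∈ with x∈p∪q⁻ ⁅ c ⁆ (fromList cs) x∈
... | inj₁ x∈⁅c⁆ = here (x∈⁅y⁆⇒x≡y c x∈⁅c⁆)
... | inj₂ x∈cs  = there (∈-fromList⁻ cs x∈cs)

length≤∣fromList∣ : ∀ {n} (cs : List (Fin n)) → Unique cs → length cs ≤ ∣ fromList cs ∣
length≤∣fromList∣ []       _           = z≤n
length≤∣fromList∣ (c ∷ cs) (c∉cs ∷ cs!) = ≤-trans (s≤s (length≤∣fromList∣ cs cs!))
  (p⊂q⇒∣p∣<∣q∣ (q⊆p∪q ⁅ c ⁆ (fromList cs) , c , x∈p∪q⁺ (inj₁ (x∈⁅x⁆ c)) ,
                All¬⇒¬Any c∉cs ∘ ∈-fromList⁻ cs))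

choose : ∀ {A B : Set} {R : A → B → Set} {P : B → Set} {xs : List A} →
  All (λ x → ∃[ y ] (R x y × P y)) xs → ∃[ ys ] (Pointwise R xs ys × All P ys)
choose []                     = [] , [] , []
choose ((y , Rxy , Py) ∷ all) with choose all
... | ys , Rxsys , Pys = y ∷ ys , Rxy ∷ Rxsys , Py ∷ Pys

EndpointOf : ∀ {A : Set} → A × A → A → Set
EndpointOf (u , w) c = c ≡ u ⊎ c ≡ w

endpoints-∈ : ∀ {n} {M : List (Fin n × Fin n)} {cs} → Pointwise EndpointOf M cs →
  All (_∈ endpoints M) cs
endpoints-∈ []                = []
endpoints-∈ (inj₁ refl ∷ rest) = here refl ∷ All.map (there ∘ there) (endpoints-∈ rest)
endpoints-∈ (inj₂ refl ∷ rest) = there (here refl) ∷ All.map (there ∘ there) (endpoints-∈ rest)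

chosenEndpoints-unique : ∀ {n} {M : List (Fin n × Fin n)} {cs} →
  Unique (endpoints M) → Pointwise EndpointOf M cs → Unique cs
chosenEndpoints-unique _                        []           = []
chosenEndpoints-unique ((_ ∷ u∉) ∷ w∉ ∷ unique) (c≡ ∷ rest) =
  All.map (distinct c≡) (endpoints-∈ rest) ∷ chosenEndpoints-unique unique rest
  where
  distinct : ∀ {c x} → EndpointOf _ c → x ∈ _ → c ≢ x
  distinct (inj₁ refl) x∈ = All.lookup u∉ x∈
  distinct (inj₂ refl) x∈ = All.lookup w∉ x∈

assignmentOf : ∀ {n} → List (Lit n) → Assignment n
assignmentOf []            v = true
assignmentOf ((x , b) ∷ L) v = if does (v ≟ x) then b else assignmentOf L v

assignmentOf-satisfies : ∀ {n} (L : List (Lit n)) → AllPairs (λ x y → var x ≢ var y) L →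
  All (Holds (assignmentOf L)) L
assignmentOf-satisfies []            []           = []
assignmentOf-satisfies ((x , b) ∷ L) (x∉ ∷ L!) =
  head ∷ All.zipWith (λ (x≢ , holds) → tail x≢ holds) (x∉ , assignmentOf-satisfies L L!)
  where
  head : Holds (assignmentOf ((x , b) ∷ L)) (x , b)
  head rewrite dec-true (x ≟ x) refl = refl
  tail : ∀ {l} → var (x , b) ≢ var l → Holds (assignmentOf L) l → Holds (assignmentOf ((x , b) ∷ L)) l
  tail {l} x≢ holds rewrite dec-false (proj₁ l ≟ x) (x≢ ∘ ≡.sym) = holds

module PathProperties {n : ℕ} (Z : BP n) where
  open BP Z

  pathLength : ∀ {a b} → Path Z a b → ℕ
  pathLength []           = 0
  pathLength (step _ _ P) = suc (pathLength P)

  infixr 5 _++ₚ_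
  _++ₚ_ : ∀ {a b c} → Path Z a b → Path Z b c → Path Z a c
  []           ++ₚ Q = Q
  step e p P ++ₚ Q = step e p (P ++ₚ Q)

  pathEdges-++ : ∀ {a b c} (P : Path Z a b) (Q : Path Z b c) →
    pathEdges Z (P ++ₚ Q) ≡ pathEdges Z P ++ pathEdges Z Q
  pathEdges-++ []           Q = refl
  pathEdges-++ (step e _ P) Q = cong (e ∷_) (pathEdges-++ P Q)

  A-++ : ∀ {a b c} (P : Path Z a b) (Q : Path Z b c) → A Z (P ++ₚ Q) ≡ A Z P ++ A Z Q
  A-++ P Q = trans (cong (mapMaybe lab) (pathEdges-++ P Q)) (mapMaybe-++ lab (pathEdges Z P) (pathEdges Z Q))

  ∈-A-++⁻ : ∀ {a b c} (P : Path Z a b) (Q : Path Z b c) {l} → l ∈ A Z (P ++ₚ Q) → l ∈ A Z P ⊎ l ∈ A Z Q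
  ∈-A-++⁻ P Q l∈ = ∈-++⁻ (A Z P) (subst (_ ∈_) (A-++ P Q) l∈)

  ∈-A-++⁺ˡ : ∀ {a b c} (P : Path Z a b) (Q : Path Z b c) {l} → l ∈ A Z P → l ∈ A Z (P ++ₚ Q)
  ∈-A-++⁺ˡ P Q l∈ = subst (_ ∈_) (≡.sym (A-++ P Q)) (∈-++⁺ˡ l∈)

  ∈-A-++⁺ʳ : ∀ {a b c} (P : Path Z a b) (Q : Path Z b c) {l} → l ∈ A Z Q → l ∈ A Z (P ++ₚ Q)
  ∈-A-++⁺ʳ P Q l∈ = subst (_ ∈_) (≡.sym (A-++ P Q)) (∈-++⁺ʳ (A Z P) l∈)

  A-step-just : ∀ {a b e l} (p : src e ≡ a) (Q : Path Z (tgt e) b) → lab e ≡ just l →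
    A Z (step e p Q) ≡ l ∷ A Z Q
  A-step-just p Q lab≡ rewrite lab≡ = refl

  A-step-nothing : ∀ {a b e} (p : src e ≡ a) (Q : Path Z (tgt e) b) → lab e ≡ nothing →
    A Z (step e p Q) ≡ A Z Q
  A-step-nothing p Q lab≡ rewrite lab≡ = refl

  splitAt : ∀ {x y a} (Q : Path Z x y) → a ∈ pathNodes Z Q →
    Σ (Path Z x a) λ Q₁ → Σ (Path Z a y) λ Q₂ → Q₁ ++ₚ Q₂ ≡ Q
  splitAt []           (here refl) = [] , [] , refl
  splitAt (step e p Q) (here refl) = [] , step e p Q , refl
  splitAt (step e p Q) (there a∈) with splitAt Q a∈
  ... | Q₁ , Q₂ , refl = step e p Q₁ , Q₂ , refl

  head∈ : ∀ {a b} (Q : Path Z a b) → a ∈ pathNodes Z Q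
  head∈ []           = here refl
  head∈ (step _ _ _) = here refl

  labelPrefix : ∀ {x y} (i : ℕ) (Q : Path Z x y) →
    Σ (Fin m) λ a → a ∈ pathNodes Z Q × Σ (Path Z x a) λ Q₁ → A Z Q₁ ≡ take i (A Z Q)
  labelPrefix zero    Q            = _ , head∈ Q , [] , refl
  labelPrefix (suc i) []           = _ , here refl , [] , refl
  labelPrefix (suc i) (step e p Q) with lab e in lab≡
  ... | just l with labelPrefix i Q
  ...   | a , a∈ , Q₁ , eq = a , there a∈ , step e p Q₁ , trans (A-step-just p Q₁ lab≡) (cong (l ∷_) eq)
  labelPrefix (suc i) (step e p Q) | nothing with labelPrefix (suc i) Q
  ...   | a , a∈ , Q₁ , eq = a , there a∈ , step e p Q₁ , trans (A-step-nothing p Q₁ lab≡) eq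

  ∈-A⁺ : ∀ {a b e l} (p : src e ≡ a) (Q : Path Z (tgt e) b) → lab e ≡ just l → l ∈ A Z (step e p Q)
  ∈-A⁺ p Q lab≡ = subst (_ ∈_) (≡.sym (A-step-just p Q lab≡)) (here refl)

  LabelledEdgeBetween : Fin m → Fin m → Lit n → Set
  LabelledEdgeBetween x y l = ∃[ e ] (lab e ≡ just l × Path Z x (src e) × Path Z (tgt e) y)

  edgeBetween-step : ∀ {a y l} e → src e ≡ a → LabelledEdgeBetween (tgt e) y l → LabelledEdgeBetween a y l
  edgeBetween-step e p (e′ , lab′≡ , Q₁ , Q₂) = e′ , lab′≡ , step e p Q₁ , Q₂

  ∈-A⁻ : ∀ {x y l} (Q : Path Z x y) → l ∈ A Z Q → LabelledEdgeBetween x y l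
  ∈-A⁻ (step e refl Q) l∈ with lab e in lab≡ | l∈
  ... | just _  | here refl = e , lab≡ , [] , Q
  ... | just _  | there l∈Q = edgeBetween-step e refl (∈-A⁻ Q l∈Q)
  ... | nothing | l∈Q       = edgeBetween-step e refl (∈-A⁻ Q l∈Q)

  nodeAt : ∀ {x y} (Q : Path Z x y) → Fin (suc (pathLength Q)) → Fin m
  nodeAt {x} Q            zero    = x
  nodeAt     (step e p Q) (suc i) = nodeAt Q i

  pathTo : ∀ {x y} (Q : Path Z x y) j → Path Z x (nodeAt Q j)
  pathTo Q            zero    = []
  pathTo (step e p Q) (suc j) = step e p (pathTo Q j)

  segment : ∀ {x y} (Q : Path Z x y) i j → i Fin.< j →
    Σ (Path Z (nodeAt Q i) (nodeAt Q j)) (NonEmpty Z)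
  segment (step e p Q) zero    (suc j) _         = step e p (pathTo Q j) , tt
  segment (step e p Q) (suc i) (suc j) (s≤s i<j) = segment Q i j i<j

  nonEmpty⇒distinctEnds : Acyclic Z → ∀ {a b} (C : Path Z a b) → NonEmpty Z C → a ≢ b
  nonEmpty⇒distinctEnds acyclic C nonEmpty refl = acyclic C nonEmpty

  -- A longer path would visit some node twice (pigeonhole) and so contain a cycle.
  pathLength<m : Acyclic Z → ∀ {x y} (Q : Path Z x y) → pathLength Q < m
  pathLength<m acyclic Q with suc (pathLength Q) ≤? m
  ... | yes Q<m = Q<m
  ... | no Q≮m with pigeonhole (≰⇒> Q≮m) (nodeAt Q)
  ...   | i , j , i<j , same with segment Q i j i<j
  ...     | C , nonEmpty = ⊥-elim (nonEmpty⇒distinctEnds acyclic C nonEmpty same)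

  reachableWithin? : ∀ ℓ x y → Dec (Σ (Path Z x y) λ Q → pathLength Q ≤ ℓ)
  reachableWithin? zero x y with x ≟ y
  ... | yes refl = yes ([] , z≤n)
  ... | no x≢y   = no λ { ([] , _) → x≢y refl ; (step _ _ _ , ()) }
  reachableWithin? (suc ℓ) x y =
    map′ from to ((x ≟ y) ⊎-dec any? λ e → (src e ≟ x) ×-dec reachableWithin? ℓ (tgt e) y)
    where
    from : x ≡ y ⊎ (∃[ e ] (src e ≡ x × Σ (Path Z (tgt e) y) λ Q → pathLength Q ≤ ℓ)) →
      Σ (Path Z x y) λ Q → pathLength Q ≤ suc ℓ
    from (inj₁ refl)                = [] , z≤n
    from (inj₂ (e , p , Q , Q≤ℓ)) = step e p Q , s≤s Q≤ℓ
    to : (Σ (Path Z x y) λ Q → pathLength Q ≤ suc ℓ) →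
      x ≡ y ⊎ (∃[ e ] (src e ≡ x × Σ (Path Z (tgt e) y) λ Q → pathLength Q ≤ ℓ))
    to ([] , _)                 = inj₁ refl
    to (step e p Q , s≤s Q≤ℓ) = inj₂ (e , p , Q , Q≤ℓ)

  reachable? : Acyclic Z → ∀ x y → Dec (Path Z x y)
  reachable? acyclic x y =
    map′ proj₁ (λ Q → Q , <⇒≤ (pathLength<m acyclic Q)) (reachableWithin? m x y)

  labelledPath? : Acyclic Z → ∀ x y l → Dec (Σ (Path Z x y) λ Q → l ∈ A Z Q)
  labelledPath? acyclic x y l = map′ from to
    (any? λ e → (lab e ≟ₗ just l) ×-dec (reachable? acyclic x (src e) ×-dec reachable? acyclic (tgt e) y))
    where
    _≟ₗ_ : (l₁ l₂ : Maybe (Lit n)) → Dec (l₁ ≡ l₂)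
    _≟ₗ_ = Maybe.≡-dec (Product.≡-dec _≟_ Bool._≟_)
    from : LabelledEdgeBetween x y l → Σ (Path Z x y) λ Q → l ∈ A Z Q
    from (e , lab≡ , Q₁ , Q₂) = Q₁ ++ₚ step e refl Q₂ , ∈-A-++⁺ʳ Q₁ (step e refl Q₂) (∈-A⁺ refl Q₂ lab≡)
    to : (Σ (Path Z x y) λ Q → l ∈ A Z Q) → LabelledEdgeBetween x y l
    to (Q , l∈) = ∈-A⁻ Q l∈

  ∈-vars⁻ : ∀ {a b v} (Q : Path Z a b) → v ∈ vars Z Q → (v , true) ∈ A Z Q ⊎ (v , false) ∈ A Z Q
  ∈-vars⁻ Q v∈ with ∈-map⁻ var v∈
  ... | (_ , true)  , l∈ , refl = inj₁ l∈
  ... | (_ , false) , l∈ , refl = inj₂ l∈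

module _ {n} (G : Graph n) (Z : BP n) (acyclic : Acyclic Z) (readOnce : ReadOnce Z)
  (total : ∀ (P : Path Z (BP.root Z) (BP.leaf Z)) v → v ∈ vars Z P)
  (sound : ∀ (P : Path Z (BP.root Z) (BP.leaf Z)) σ → All (Holds σ) (A Z P) → SatPhi G σ) where
  open BP Z
  open PathProperties Z

  -- Read-once lets P's literals be satisfied simultaneously, and that assignment must satisfy φ(G).
  negatives-nonadjacent : (P : Path Z root leaf) → ∀ {u w} →
    (u , false) ∈ A Z P → (w , false) ∈ A Z P → ¬ Adj G u w
  negatives-nonadjacent P ¬u∈ ¬w∈ u~w =
    [ contradicts ¬u∈ , contradicts ¬w∈ ]′ (sound P σ holds _ _ u~w)
    where
    σ : Assignment n
    σ = assignmentOf (A Z P)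
    holds : All (Holds σ) (A Z P)
    holds = assignmentOf-satisfies (A Z P) (readOnce P)
    contradicts : ∀ {v} → (v , false) ∈ A Z P → σ v ≢ true
    contradicts ¬v∈ σv≡true with trans (≡.sym σv≡true) (All.lookup holds ¬v∈)
    ... | ()

  ForcedAt : Fin m → Fin n → Set
  ForcedAt a c = ∀ (Q : Path Z root leaf) → a ∈ pathNodes Z Q → InVC Z Q c

  module _ (a : Fin m) (Before : Fin n → Set)
    (readsBefore : ∀ (Q₁ : Path Z root a) v → v ∈ vars Z Q₁ ⇔ Before v) where

    crossEdge-forced : ∀ {u w} → Before u → ¬ Before w → Adj G u w →
      ∃[ c ] (EndpointOf (u , w) c × ForcedAt a c)
    crossEdge-forced {u} {w} before-u after-w u~w with labelledPath? acyclic root a (u , false)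
    ... | yes (Q₁′ , ¬u∈Q₁′) = w , inj₂ refl , w-forced
      where
      w-forced : ForcedAt a w
      w-forced Q a∈Q with splitAt Q a∈Q
      ... | Q₁ , Q₂ , refl with ∈-vars⁻ Q (total Q w)
      ...   | inj₁ w∈  = w∈
      ...   | inj₂ ¬w∈ with ∈-A-++⁻ Q₁ Q₂ ¬w∈
      ...     | inj₁ ¬w∈Q₁ = ⊥-elim (after-w (Equivalence.to (readsBefore Q₁ w) (∈-map⁺ var ¬w∈Q₁)))
      ...     | inj₂ ¬w∈Q₂ = ⊥-elim (negatives-nonadjacent (Q₁′ ++ₚ Q₂)
                               (∈-A-++⁺ˡ Q₁′ Q₂ ¬u∈Q₁′) (∈-A-++⁺ʳ Q₁′ Q₂ ¬w∈Q₂) u~w)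
    ... | no noPath = u , inj₁ refl , u-forced
      where
      u-forced : ForcedAt a u
      u-forced Q a∈Q with splitAt Q a∈Q
      ... | Q₁ , Q₂ , refl with ∈-vars⁻ Q₁ (Equivalence.from (readsBefore Q₁ u) before-u)
      ...   | inj₁ u∈Q₁  = ∈-A-++⁺ˡ Q₁ Q₂ u∈Q₁
      ...   | inj₂ ¬u∈Q₁ = ⊥-elim (noPath (Q₁ , ¬u∈Q₁))

    crossMatching⇒tNode : ∀ {M} → IsCrossMatching G Before M → IsTNode Z (length M) a
    crossMatching⇒tNode {M} (edges , unique)
      with choose (All.map (λ (before-u , after-w , u~w) → crossEdge-forced before-u after-w u~w) edges)
    ... | cs , chosen , forced = fromList cs , |M|≤|cs| , λ Q a∈Q v v∈ → All.lookup forced (∈-fromList⁻ cs v∈) Q a∈Q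
      where
      |M|≤|cs| : length M ≤ ∣ fromList cs ∣
      |M|≤|cs| = subst (_≤ ∣ fromList cs ∣) (≡.sym (Pointwise-length chosen))
                       (length≤∣fromList∣ cs (chosenEndpoints-unique unique chosen))

lemma1 : ∀ {n} (G : Graph n) (t : ℕ) → 0 < t → NoIsolated G → MwAtLeast G t →
    (Z : BP n) → IsNROBP Z → Uniform Z → Computes Z (SatPhi G) →
    ∀ (P : Path Z (BP.root Z) (BP.leaf Z)) →
      ∃[ a ] (a ∈ pathNodes Z P × IsTNode Z t a)
lemma1 G t _ _ mw Z (acyclic , _ , readOnce) (sameVars , total) (sound , _) P
  with enumeration⇒permutation (vars Z P) (AllPairs.map⁺ (readOnce P)) (total P)
... | π , prefix with mw π
...   | i , _ , M , crossing , t≤|M| with PathProperties.labelPrefix Z i P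
...     | a , a∈P , P₁ , P₁≡
  with crossMatching⇒tNode G Z acyclic readOnce total sound a (InPrefix π i) readsBefore crossing
  where
  varsP₁ : vars Z P₁ ≡ take i (vars Z P)
  varsP₁ = trans (cong (map var) P₁≡) (≡.sym (take-map i (A Z P)))
  readsBefore : ∀ Q₁ v → v ∈ vars Z Q₁ ⇔ InPrefix π i v
  readsBefore Q₁ v =
    ⇔-sym (prefix i v) ⇔-∘ (mk⇔ (subst (v ∈_) varsP₁) (subst (v ∈_) (≡.sym varsP₁)) ⇔-∘ sameVars Q₁ P₁ v)
... | S , |M|≤|S| , forced = a , a∈P , S , ≤-trans t≤|M| |M|≤|S| , forced
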